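{- Let $C$ be a set of pairwise edge-disjoint cycles on a vertex set $V$, each of length at most $k$. Let $P$ be a partition that is good for $C$ such that $\mathcal G_P(C)$ contains no self-loops. Let $Q$ be the set of vertices that have at most $6$ distinct neighbors in $\mathcal G_P(C)$. If every cycle in $C$ contains at least one vertex from $Q$, then there is a subset $C'\subseteq C$ with $|C'|\ge 12^{ -2k}|C|$ such that every cycle $\mathfrak c\in C'$ contains a vertex $v\in Q$ that is well-contractible in $\mathcal G_P(C')$.
   Context: A map $P:V\to V$ is a good partition for $C$ if: (i) $P(u)=u$ for every $u$ in the image of $P$ (heads); (ii) $P(u)=u$ for every $u$ on no cycle of $C$; (iii) for each $\mathfrak c\in C$ and head $u$, if $P^{ -1}(u)$ meets $\mathfrak c$ then $u\in\mathfrak c$; (iv) for each $\mathfrak c\in C$ and head $u$, $P^{ -1}(u)\cap V(\mathfrak c)$ is empty, all of $V(\mathfrak c)$, or the vertex set of a path in $\mathfrak c$. $P(\mathfrak c)$ is the cycle obtained from $\mathfrak c$ by contracting each class into its head (vertices: the heads of the classes met by $\mathfrak c$ in cyclic order, one edge between consecutive heads; a self-loop if one class is met; two parallel edges, one per arc, if exactly two). Each edge of $P(\mathfrak c)$ between heads $u,v$ has a parity: the length mod 2 of the corresponding arc of $\mathfrak c$ from $u$ to $v$. For $C''\subseteq C$, $\mathcal G_P(C'')$ is the multigraph on the image of $P$ whose edge multiset (with parities) is the union of the edges of $P(\mathfrak c)$, $\mathfrak c\in C''$. A cycle $\mathfrak c$ contains a vertex $v$ of this multigraph if $P(\mathfrak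 c)$ passes through $v$. A vertex $v$ is well-contractible in $\mathcal G_P(C'')$ if either $v$ has exactly one distinct neighbor in $\mathcal G_P(C'')$, or $v$ has exactly two distinct neighbors $x,y$ and (a) every cycle of $C''$ containing $v$ also contains $x$ and $y$, and (b) all edges between $x$ and $v$ have the same parity and all edges between $v$ and $y$ have the same parity. -}

module Defs where

open import Data.Nat using (ℕ; zero; suc; _+_; _*_; _∸_; _^_; _≤_; _<_; _≤ᵇ_)
open import Data.Nat.DivMod using (_%_; m%n<n)
open import Data.Fin using (Fin; toℕ; fromℕ<; _≟_)
open import Data.Fin.Subset using (Subset) renaming (_∈_ to _∈ₛ_)
open import Data.List using (List; []; _∷_; length; lookup)
open import Data.List.Membership.Propositional using (_∈_; _∉_)
open import Data.List.Relation.Unary.Unique.Propositional using (Unique)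
open import Data.Product using (Σ; ∃; ∃-syntax; _×_; _,_)
open import Data.Sum using (_⊎_)
open import Data.Bool using (if_then_else_)
open import Relation.Nullary using (¬_; does)
open import Relation.Binary.PropositionalEquality using (_≡_; _≢_)

-- A cycle is a list of distinct vertices
-- (cyclic order), of length ≥ 3; its edges are the consecutive pairs
-- (including last–first).  Its length (number of edges) = length of list.

IsCycle : ∀ {n} → List (Fin n) → Set
IsCycle xs = Unique xs × 3 ≤ length xs

next : ∀ {L} → Fin L → Fin L
next {suc L} i = fromℕ< (m%n<n (suc (toℕ i)) (suc L))

fwd : ℕ → ℕ → ℕ → ℕ
fwd L a b = if a ≤ᵇ b then b ∸ a else (L ∸ a) + b

pos : ∀ {n} → Fin n → List (Fin n) → ℕ
pos v [] = zero
pos v (x ∷ xs) = if does (v ≟ x) then zero else suc (pos v xs)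

CycEdge : ∀ {n} → List (Fin n) → Fin n → Fin n → Set
CycEdge xs a b = Σ (Fin (length xs)) λ p → lookup xs p ≡ a × lookup xs (next p) ≡ b

-- Cycle systems C : Fin m → List (Fin n), sub-collections as Subset m.

module _ {n m : ℕ} (C : Fin m → List (Fin n)) where

  EdgeDisjoint : Set
  EdgeDisjoint = ∀ i j → i ≢ j → ∀ a b → CycEdge (C i) a b →
                 ¬ (CycEdge (C j) a b ⊎ CycEdge (C j) b a)

  module _ (P : Fin n → Fin n) where

    Head : Fin n → Set
    Head u = ∃[ w ] P w ≡ u

    -- P⁻¹(u) ∩ V(c) is the vertex set of a path in c (a contiguous arc
    -- with l vertices, 1 ≤ l ≤ L, starting at position s)
    IsPathClass : List (Fin n) → Fin n → Set
    IsPathClass xs u = Σ (Fin (length xs)) λ s → Σ ℕ λ l →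
      1 ≤ l × l ≤ length xs ×
      (∀ q → (P (lookup xs q) ≡ u → fwd (length xs) (toℕ s) (toℕ q) < l)
           × (fwd (length xs) (toℕ s) (toℕ q) < l → P (lookup xs q) ≡ u))

    GoodPartition : Set
    GoodPartition =
      (∀ u → Head u → P u ≡ u) ×
      (∀ u → (∀ i → u ∉ C i) → P u ≡ u) ×
      (∀ i u → Head u → (∃[ w ] (w ∈ C i × P w ≡ u)) → u ∈ C i) ×
      (∀ i u → Head u →
          (∀ w → w ∈ C i → P w ≢ u)
        ⊎ (∀ w → w ∈ C i → P w ≡ u)
        ⊎ IsPathClass (C i) u)

    -- Edges of the contracted cycle P(c) = C i.  Each boundary position p
    -- (P c[p] ≠ P c[p+1]) gives one edge from u = P c[p] to v = P c[p+1],
    -- whose parity is the length mod 2 of the arc of c from u forward to v.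
    -- If c meets a single class u, P(c) is a self-loop at u (parity = |c| mod 2).
    ContrEdge : List (Fin n) → Fin n → Fin n → ℕ → Set
    ContrEdge xs u v b =
      (Σ (Fin (length xs)) λ p →
        P (lookup xs p) ≡ u × P (lookup xs (next p)) ≡ v × u ≢ v ×
        fwd (length xs) (pos u xs) (pos v xs) % 2 ≡ b)
      ⊎ (u ≡ v × 0 < length xs × (∀ p → P (lookup xs p) ≡ u) × length xs % 2 ≡ b)

    SelfLoop : List (Fin n) → Fin n → Set
    SelfLoop xs u = 0 < length xs × (∀ p → P (lookup xs p) ≡ u)

    Contains : List (Fin n) → Fin n → Set
    Contains xs v = ∃[ p ] P (lookup xs p) ≡ v

    module _ (S : Subset m) where

      EdgeBetween : Fin n → Fin n → ℕ → Set
      EdgeBetween u v b = ∃[ i ] (i ∈ₛ S × (ContrEdge (C i) u v b ⊎ ContrEdge (C i) v u b))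

      Adj : Fin n → Fin n → Set
      Adj v w = ∃[ b ] EdgeBetween v w b

      SameParity : Fin n → Fin n → Set
      SameParity a c = ∀ b₁ b₂ → EdgeBetween a c b₁ → EdgeBetween a c b₂ → b₁ ≡ b₂

      WellContractible : Fin n → Set
      WellContractible v =
        (∃[ x ] (Adj v x × (∀ w → Adj v w → w ≡ x)))
        ⊎ (∃[ x ] ∃[ y ] (x ≢ y × Adj v x × Adj v y ×
             (∀ w → Adj v w → w ≡ x ⊎ w ≡ y) ×
             (∀ i → i ∈ₛ S → Contains (C i) v → Contains (C i) x × Contains (C i) y) ×
             SameParity x v × SameParity v y))

      AtMostNbrs : ℕ → Fin n → Set
      AtMostNbrs d v = Head v × Σ (List (Fin n)) λ ns → length ns ≤ d × (∀ w → Adj v w → w ∈ ns)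

module Submission where

-- The class of a head v meets a cycle c through v in a proper arc (P(c) has no self-loops), so
-- the contracted cycle P(c) leaves v along exactly one edge and enters it along exactly one.
-- Call v marked if it is the given low-degree vertex of some cycle, and label each pair (c, v)
-- with v marked on P(c) by the neighbour indices (< 6) and parities of these two edges: 12² labels.
-- A cycle has at most k such pairs, so a uniformly random labelling σ of the vertices agrees with
-- all labels of a fixed cycle with probability at least 12^(-2k), and the method of conditional
-- expectations, fixing σ one vertex at a time, finds a σ agreeing with a 12^(-2k) fraction of C.
-- In the subfamily C′ of cycles agreeing with σ, all cycles through a marked vertex v leave and
-- enter it through the same neighbours x, y with the same parities: v is well-contractible.

open import Defs
open import Data.Nat using (ℕ; zero; suc; _+_; _*_; _∸_; _^_; _≤_; _<_; z≤n; s≤s; s≤s⁻¹; z<s; _≤ᵇ_; _≤?_; _<?_; NonZero; >-nonZero)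
open import Data.Nat.Properties hiding (_≟_)
import Data.Nat.Properties as ℕ
open import Data.Nat.DivMod using (_%_; _mod_; m%n<n; m<n⇒m%n≡m; n%n≡0)
open import Algebra.Properties.Semiring.Sum +-*-semiring using (sum-syntax; ∑-comm; *-distribˡ-sum; sum-cong-≗)
open import Data.Fin using (Fin; zero; suc; toℕ; fromℕ<; _≟_; inject≤; combine; remQuot)
open import Data.Fin.Properties using (toℕ<n; toℕ-injective; toℕ-fromℕ<; any?; inject≤-injective; remQuot-combine)
open import Data.Fin.Subset using (Subset; ⊤; ∣_∣) renaming (_∈_ to _∈ₛ_)
open import Data.Fin.Subset.Properties using (∈⊤)
open import Data.Vec using (tabulate)
open import Data.Vec.Properties using (lookup∘tabulate; []=⇒lookup)
open import Data.Vec.Functional using () renaming (_∷_ to _◂_)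
open import Data.Bool using (true; false; if_then_else_)
open import Data.Maybe using (Maybe; just; nothing)
open import Data.List using (List; []; _∷_; length; lookup; map)
open import Data.List.Properties using (length-map)
open import Data.List.Membership.Propositional using (_∈_)
open import Data.List.Membership.Propositional.Properties using (∈-lookup; ∈-map⁺)
open import Data.List.Relation.Unary.Any using (here; there; index)
open import Data.List.Relation.Unary.Any.Properties using (lookup-index)
open import Data.Product using (Σ; Σ-syntax; ∃-syntax; _×_; _,_; proj₁; proj₂)
open import Data.Product.Properties using (,-injective)
open import Data.Sum using (_⊎_; inj₁; inj₂; reduce)
open import Function using (_∘_)
open import Relation.Nullary using (Dec; yes; no; ¬_; does)
open import Relation.Nullary.Negation using (contradiction)
open import Relation.Binary.PropositionalEquality using (_≡_; _≢_; refl; sym; trans; cong; subst; module ≡-Reasoning)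

∑-const : ∀ k a → ∑[ i < k ] a ≡ k * a
∑-const zero    a = refl
∑-const (suc k) a = cong (a +_) (∑-const k a)

∑-indicator : ∀ {k} (t : Fin k) a → ∑[ s < k ] (if does (t ≟ s) then a else 0) ≡ a
∑-indicator {suc k} zero    a = trans (cong (a +_) (trans (∑-const k 0) (*-zeroʳ k))) (+-identityʳ a)
∑-indicator {suc k} (suc t) a = ∑-indicator t a

∑<* : ∀ {k} .{{_ : NonZero k}} (g : Fin k → ℕ) {X} → (∀ i → g i < X) → ∑[ i < k ] g i < k * X
∑<* {suc zero}    g g<X = +-monoˡ-< 0 (g<X zero)
∑<* {suc (suc k)} g g<X = +-mono-< (g<X zero) (∑<* (g ∘ suc) (g<X ∘ suc))

pigeonhole : ∀ {k} .{{_ : NonZero k}} (g : Fin k → ℕ) {X} → k * X ≤ ∑[ i < k ] g i → ∃[ i ] X ≤ g i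
pigeonhole g {X} k*X≤∑ with any? (λ i → X ≤? g i)
... | yes found = found
... | no none   = contradiction k*X≤∑ (<⇒≱ (∑<* g λ i → ≰⇒> λ X≤gi → none (i , X≤gi)))

support : ∀ {m} → (Fin m → ℕ) → Subset m
support g = tabulate (λ i → does (0 <? g i))

∈-support : ∀ {m} {g : Fin m → ℕ} {i} → i ∈ₛ support g → 0 < g i
∈-support {g = g} {i} i∈ with g i | trans (sym (lookup∘tabulate (λ i → does (0 <? g i)) i)) ([]=⇒lookup i∈)
... | suc _ | _ = z<s

∑≤*∣support∣ : ∀ {m} (g : Fin m → ℕ) {B} → (∀ i → g i ≤ B) → (∑[ i < m ] g i) ≤ B * ∣ support g ∣
∑≤*∣support∣ {zero}  g     _   = z≤n
∑≤*∣support∣ {suc m} g {B} g≤B with g zero | g≤B zero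
... | zero  | _       = ∑≤*∣support∣ (g ∘ suc) (g≤B ∘ suc)
... | suc _ | g₀≤B = ≤-trans (+-mono-≤ g₀≤B (∑≤*∣support∣ (g ∘ suc) (g≤B ∘ suc))) (≤-reflexive (sym (*-suc B _)))

*-positive⁻¹ : ∀ {a b} → 0 < a * b → 0 < a × 0 < b
*-positive⁻¹ {suc _} {suc _} _   = z<s , z<s
*-positive⁻¹ {suc a} {zero}  pos = contradiction (subst (0 <_) (*-zeroʳ a) pos) λ ()

sucPreimage : ∀ {n} → List (Fin (suc n)) → List (Fin n)
sucPreimage []           = []
sucPreimage (zero  ∷ xs) = sucPreimage xs
sucPreimage (suc x ∷ xs) = x ∷ sucPreimage xs

length-sucPreimage≤ : ∀ {n} (xs : List (Fin (suc n))) → length (sucPreimage xs) ≤ length xs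
length-sucPreimage≤ []           = z≤n
length-sucPreimage≤ (zero  ∷ xs) = m≤n⇒m≤1+n (length-sucPreimage≤ xs)
length-sucPreimage≤ (suc x ∷ xs) = s≤s (length-sucPreimage≤ xs)

length-sucPreimage< : ∀ {n} {xs : List (Fin (suc n))} → zero ∈ xs → length (sucPreimage xs) < length xs
length-sucPreimage< {xs = zero  ∷ xs} _          = s≤s (length-sucPreimage≤ xs)
length-sucPreimage< {xs = suc x ∷ xs} (there 0∈) = s≤s (length-sucPreimage< 0∈)

∈-sucPreimage : ∀ {n} {v : Fin n} {xs} → suc v ∈ xs → v ∈ sucPreimage xs
∈-sucPreimage {xs = zero  ∷ xs} (there v∈)  = ∈-sucPreimage v∈
∈-sucPreimage {xs = suc x ∷ xs} (here refl) = here refl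
∈-sucPreimage {xs = suc x ∷ xs} (there v∈)  = there (∈-sucPreimage v∈)

-- Partial assignments and the method of conditional expectations

module _ {T : ℕ} where

  gain : Maybe (Fin T) → Fin T → ℕ
  gain nothing  _ = 1
  gain (just t) s = if does (t ≟ s) then T else 0

  ∑-gain : ∀ mt → ∑[ s < T ] gain mt s ≡ T
  ∑-gain nothing  = trans (∑-const T 1) (*-identityʳ T)
  ∑-gain (just t) = ∑-indicator t T

  gain-positive : ∀ {t s} → 0 < gain (just t) s → t ≡ s
  gain-positive {t} {s} pos with t ≟ s
  ... | yes t≡s = t≡s

  gain≤ : ∀ t s → gain (just t) s ≤ T
  gain≤ t s with t ≟ s
  ... | yes _ = ≤-refl
  ... | no  _ = z≤n

  -- T ^ (number of points where c is defined) if σ extends c, and 0 otherwise;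
  -- its average over all σ is 1.
  weight : ∀ {n} → (Fin n → Maybe (Fin T)) → (Fin n → Fin T) → ℕ
  weight {zero}  c σ = 1
  weight {suc n} c σ = gain (c zero) (σ zero) * weight (c ∘ suc) (σ ∘ suc)

  weight-positive : ∀ {n} (c : Fin n → Maybe (Fin T)) σ → 0 < weight c σ → ∀ v {t} → c v ≡ just t → t ≡ σ v
  weight-positive c σ pos zero    c₀≡t with c zero | *-positive⁻¹ {gain (c zero) (σ zero)} pos
  weight-positive c σ pos zero refl | just t | gain>0 , _ = gain-positive gain>0
  weight-positive c σ pos (suc v) cᵥ≡t =
    weight-positive (c ∘ suc) (σ ∘ suc) (proj₂ (*-positive⁻¹ {gain (c zero) (σ zero)} pos)) v cᵥ≡t

  weight≤ : ∀ {n} .{{_ : NonZero T}} (c : Fin n → Maybe (Fin T)) σ xs →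
            (∀ {v t} → c v ≡ just t → v ∈ xs) → weight c σ ≤ T ^ length xs
  weight≤ {zero}  c σ xs _ = m^n>0 T (length xs)
  weight≤ {suc n} c σ xs domain with c zero in c₀
  ... | nothing = begin
    1 * weight (c ∘ suc) (σ ∘ suc) ≡⟨ *-identityˡ _ ⟩
    weight (c ∘ suc) (σ ∘ suc)     ≤⟨ weight≤ (c ∘ suc) (σ ∘ suc) (sucPreimage xs) (∈-sucPreimage ∘ domain) ⟩
    T ^ length (sucPreimage xs)    ≤⟨ ^-monoʳ-≤ T (length-sucPreimage≤ xs) ⟩
    T ^ length xs                  ∎
    where open ≤-Reasoning
  ... | just t = begin
    gain (just t) (σ zero) * weight (c ∘ suc) (σ ∘ suc)
      ≤⟨ *-mono-≤ (gain≤ t (σ zero)) (weight≤ (c ∘ suc) (σ ∘ suc) (sucPreimage xs) (∈-sucPreimage ∘ domain)) ⟩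
    T ^ suc (length (sucPreimage xs))
      ≤⟨ ^-monoʳ-≤ T (length-sucPreimage< (domain c₀)) ⟩
    T ^ length xs
      ∎
    where open ≤-Reasoning

  derandomise : ∀ {m} n .{{_ : NonZero T}} (w : Fin m → ℕ) (c : Fin m → Fin n → Maybe (Fin T)) →
                ∃[ σ ] (∑[ i < m ] w i) ≤ (∑[ i < m ] (w i * weight (c i) σ))
  derandomise zero w c = (λ ()) , ≤-reflexive (sum-cong-≗ λ i → sym (*-identityʳ (w i)))
  derandomise {m} (suc n) w c =
    let s , s-good = pigeonhole (λ s → ∑[ i < m ] w-given s i) (≤-reflexive (sym total))
        σ , σ-good = derandomise n (w-given s) (λ i → c i ∘ suc)
    in s ◂ σ , (begin
      ∑[ i < m ] w i                                   ≤⟨ s-good ⟩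
      ∑[ i < m ] w-given s i                           ≤⟨ σ-good ⟩
      ∑[ i < m ] (w-given s i * weight (c i ∘ suc) σ)  ≡⟨ sum-cong-≗ (λ i → *-assoc (w i) _ _) ⟩
      ∑[ i < m ] (w i * weight (c i) (s ◂ σ))          ∎)
    where
    open ≤-Reasoning
    w-given : Fin T → Fin m → ℕ
    w-given s i = w i * gain (c i zero) s
    total : (∑[ s < T ] ∑[ i < m ] w-given s i) ≡ T * (∑[ i < m ] w i)
    total = begin-equality
      ∑[ s < T ] ∑[ i < m ] w-given s i                  ≡⟨ ∑-comm w-given ⟩
      ∑[ i < m ] ∑[ s < T ] w-given s i                  ≡⟨ sum-cong-≗ (λ i → *-distribˡ-sum (w i) (gain (c i zero))) ⟨
      ∑[ i < m ] (w i * (∑[ s < T ] gain (c i zero) s))  ≡⟨ sum-cong-≗ (λ i → cong (w i *_) (∑-gain (c i zero))) ⟩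
      ∑[ i < m ] (w i * T)                               ≡⟨ sum-cong-≗ (λ i → *-comm (w i) T) ⟩
      ∑[ i < m ] (T * w i)                               ≡⟨ *-distribˡ-sum T w ⟨
      T * (∑[ i < m ] w i)                               ∎

  agreeing-assignment : ∀ {n m} .{{_ : NonZero T}} K (c : Fin m → Fin n → Maybe (Fin T)) (dom : Fin m → List (Fin n)) →
    (∀ i → length (dom i) ≤ K) → (∀ i {v t} → c i v ≡ just t → v ∈ dom i) →
    ∃[ σ ] Σ[ S ∈ Subset m ] m ≤ T ^ K * ∣ S ∣ × (∀ i → i ∈ₛ S → ∀ v {t} → c i v ≡ just t → t ≡ σ v)
  agreeing-assignment {n} {m} K c dom |dom|≤K c⊆dom =
    let σ , σ-good = derandomise n (λ _ → 1) c
        g = λ i → weight (c i) σ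
    in σ , support g , (begin
      m                        ≡⟨ trans (∑-const m 1) (*-identityʳ m) ⟨
      ∑[ i < m ] 1             ≤⟨ σ-good ⟩
      ∑[ i < m ] (1 * g i)     ≡⟨ sum-cong-≗ (*-identityˡ ∘ g) ⟩
      ∑[ i < m ] g i           ≤⟨ ∑≤*∣support∣ g (λ i → ≤-trans (weight≤ (c i) σ (dom i) (c⊆dom i)) (^-monoʳ-≤ T (|dom|≤K i))) ⟩
      T ^ K * ∣ support g ∣    ∎)
    , λ i i∈S → weight-positive (c i) σ (∈-support {g = g} i∈S)
    where open ≤-Reasoning

-- Forward distance around a cycle

fwd-≤ : ∀ L {a b} → a ≤ b → fwd L a b ≡ b ∸ a
fwd-≤ L {a} {b} a≤b with a ≤ᵇ b | ≤⇒≤ᵇ a≤b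
... | true | _ = refl

fwd-> : ∀ L {a b} → b < a → fwd L a b ≡ L ∸ a + b
fwd-> L {a} {b} b<a with a ≤ᵇ b | ≤ᵇ⇒≤ a b
... | true  | ≤ᵇ⇒a≤b = contradiction (≤ᵇ⇒a≤b _) (<⇒≱ b<a)
... | false | _       = refl

module _ {L a : ℕ} (a<L : a < L) where

  fwd-< : ∀ {b} → b < L → fwd L a b < L
  fwd-< {b} b<L with a ≤? b
  ... | yes a≤b rewrite fwd-≤ L a≤b = ≤-<-trans (m∸n≤m b a) b<L
  ... | no a≰b  rewrite fwd-> L (≰⇒> a≰b) =
    subst (L ∸ a + b <_) (m∸n+n≡m (<⇒≤ a<L)) (+-monoʳ-< (L ∸ a) (≰⇒> a≰b))

  fwd-injective : ∀ {b c} → b < L → c < L → fwd L a b ≡ fwd L a c → b ≡ c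
  fwd-injective {b} {c} b<L c<L eq with a ≤? b | a ≤? c
  ... | yes a≤b | yes a≤c rewrite fwd-≤ L a≤b | fwd-≤ L a≤c =
    trans (sym (m∸n+n≡m a≤b)) (trans (cong (_+ a) eq) (m∸n+n≡m a≤c))
  ... | yes a≤b | no a≰c rewrite fwd-≤ L a≤b | fwd-> L (≰⇒> a≰c) =
    contradiction eq (<⇒≢ (≤-trans (∸-monoˡ-< b<L a≤b) (m≤m+n (L ∸ a) c)))
  ... | no a≰b | yes a≤c rewrite fwd-> L (≰⇒> a≰b) | fwd-≤ L a≤c =
    contradiction (sym eq) (<⇒≢ (≤-trans (∸-monoˡ-< c<L a≤c) (m≤m+n (L ∸ a) b)))
  ... | no a≰b | no a≰c rewrite fwd-> L (≰⇒> a≰b) | fwd-> L (≰⇒> a≰c) =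
    +-cancelˡ-≡ (L ∸ a) b c eq

  fwd-surjective : ∀ {t} → t < L → ∃[ b ] b < L × fwd L a b ≡ t
  fwd-surjective {t} t<L with a + t <? L
  ... | yes a+t<L = a + t , a+t<L , trans (fwd-≤ L (m≤m+n a t)) (m+n∸m≡n a t)
  ... | no a+t≮L  = b , <-trans b<a a<L , trans (fwd-> L b<a) (+-cancelʳ-≡ a _ t wraps)
    where
    L≤a+t : L ≤ a + t
    L≤a+t = ≮⇒≥ a+t≮L
    b = a + t ∸ L
    b<a : b < a
    b<a = +-cancelʳ-< L b a (subst (_< a + L) (sym (m∸n+n≡m L≤a+t)) (+-monoʳ-< a t<L))
    wraps : L ∸ a + b + a ≡ t + a
    wraps = begin
      L ∸ a + b + a   ≡⟨ +-assoc (L ∸ a) b a ⟩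
      L ∸ a + (b + a) ≡⟨ cong (L ∸ a +_) (+-comm b a) ⟩
      L ∸ a + (a + b) ≡⟨ +-assoc (L ∸ a) a b ⟨
      L ∸ a + a + b   ≡⟨ cong (_+ b) (m∸n+n≡m (<⇒≤ a<L)) ⟩
      L + b           ≡⟨ m+[n∸m]≡n L≤a+t ⟩
      a + t           ≡⟨ +-comm a t ⟩
      t + a           ∎
      where open ≡-Reasoning

CyclicSucc : ℕ → ℕ → ℕ → Set
CyclicSucc L x y = y ≡ suc x ⊎ (y ≡ 0 × suc x ≡ L)

fwd-wrap : ∀ {a b} → a < suc b → CyclicSucc (suc b) (fwd (suc b) a b) (fwd (suc b) a 0)
fwd-wrap {zero}   _   = inj₂ (refl , refl)
fwd-wrap {suc a′} {b} a<L rewrite fwd-≤ (suc b) (s≤s⁻¹ a<L) | fwd-> (suc b) (s≤s (z≤n {a′})) =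
  inj₁ (trans (+-identityʳ (b ∸ a′)) (+-∸-assoc 1 (s≤s⁻¹ a<L)))

fwd-cyclicSucc : ∀ {L a b c} → a < L → b < L → CyclicSucc L b c → CyclicSucc L (fwd L a b) (fwd L a c)
fwd-cyclicSucc {L} {a} {b} a<L b<L (inj₁ refl) with a ≤? b | a ℕ.≟ suc b
... | yes a≤b | _ rewrite fwd-≤ L a≤b | fwd-≤ L (m≤n⇒m≤1+n a≤b) = inj₁ (+-∸-assoc 1 a≤b)
... | no _    | yes refl rewrite fwd-> L (n<1+n b) | fwd-≤ L (≤-refl {suc b}) | n∸n≡0 b =
  inj₂ (refl , trans (sym (+-suc (L ∸ suc b) b)) (m∸n+n≡m b<L))
... | no a≰b  | no a≢b+1 rewrite fwd-> L (≰⇒> a≰b) | fwd-> L (≤∧≢⇒< (≰⇒> a≰b) (a≢b+1 ∘ sym)) =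
  inj₁ (+-suc (L ∸ a) b)
fwd-cyclicSucc a<L _ (inj₂ (refl , refl)) = fwd-wrap a<L

toℕ-next : ∀ {L} (q : Fin L) → CyclicSucc L (toℕ q) (toℕ (next q))
toℕ-next {suc L} q rewrite toℕ-fromℕ< (m%n<n (suc (toℕ q)) (suc L)) with suc (toℕ q) <? suc L
... | yes q+1<L = inj₁ (m<n⇒m%n≡m q+1<L)
... | no q+1≮L  = inj₂ (trans (cong (_% suc L) q+1≡L) (n%n≡0 (suc L)) , q+1≡L)
  where q+1≡L = ≤-antisym (toℕ<n q) (≮⇒≥ q+1≮L)

offset : ∀ {L} → Fin L → Fin L → ℕ
offset {L} s q = fwd L (toℕ s) (toℕ q)

module _ {L} (s : Fin L) where

  offset-< : ∀ q → offset s q < L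
  offset-< q = fwd-< (toℕ<n s) (toℕ<n q)

  offset-injective : ∀ {p q} → offset s p ≡ offset s q → p ≡ q
  offset-injective {p} {q} eq = toℕ-injective (fwd-injective (toℕ<n s) (toℕ<n p) (toℕ<n q) eq)

  offset-surjective : ∀ {t} → t < L → ∃[ q ] offset s q ≡ t
  offset-surjective t<L with fwd-surjective (toℕ<n s) t<L
  ... | b , b<L , eq = fromℕ< b<L , trans (cong (fwd L (toℕ s)) (toℕ-fromℕ< b<L)) eq

  offset-next : ∀ q → CyclicSucc L (offset s q) (offset s (next q))
  offset-next q = fwd-cyclicSucc (toℕ<n s) (toℕ<n q) (toℕ-next q)

module ProperArc {L} (In : Fin L → Set) (s : Fin L) (l : ℕ) (1≤l : 1 ≤ l)
                 (arc : ∀ q → (In q → offset s q < l) × (offset s q < l → In q))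
                 (proper : ¬ (∀ q → In q)) where

  private
    instance
      l≢0 : NonZero l
      l≢0 = >-nonZero 1≤l

    in⇒< : ∀ {q} → In q → offset s q < l
    in⇒< = proj₁ (arc _)

    <⇒in : ∀ {q} → offset s q < l → In q
    <⇒in = proj₂ (arc _)

  l<L : l < L
  l<L with l <? L
  ... | yes l<L = l<L
  ... | no l≮L  = contradiction (λ q → <⇒in (<-≤-trans (offset-< s q) (≮⇒≥ l≮L))) proper

  private
    instance
      L≢0 : NonZero L
      L≢0 = >-nonZero (≤-trans 1≤l (<⇒≤ l<L))

  exit-offset : ∀ {p} → In p → ¬ In (next p) → suc (offset s p) ≡ l
  exit-offset {p} in-p out-next with offset-next s p
  ... | inj₁ eq       = ≤-antisym (in⇒< in-p) (≮⇒≥ λ p+1<l → out-next (<⇒in (subst (_< l) (sym eq) p+1<l)))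
  ... | inj₂ (eq , _) = contradiction (<⇒in (subst (_< l) (sym eq) 1≤l)) out-next

  entry-offset : ∀ {p} → ¬ In p → In (next p) → suc (offset s p) ≡ L
  entry-offset {p} out-p in-next with offset-next s p
  ... | inj₁ eq       = contradiction (<⇒in (<-trans (n<1+n _) (subst (_< l) eq (in⇒< in-next)))) out-p
  ... | inj₂ (_ , eq) = eq

  exit : ∃[ p ] In p × ¬ In (next p)
  exit with offset-surjective s (<-trans (≤-reflexive (suc-pred l)) l<L)
  ... | p , eq = p , <⇒in (subst (_< l) (sym eq) (≤-reflexive (suc-pred l))) , out-next
    where
    p+1≡l : suc (offset s p) ≡ l
    p+1≡l = trans (cong suc eq) (suc-pred l)
    out-next : ¬ In (next p)
    out-next in-next with offset-next s p
    ... | inj₁ eq′       = <-irrefl (trans eq′ p+1≡l) (in⇒< in-next)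
    ... | inj₂ (_ , eq′) = <-irrefl (trans (sym p+1≡l) eq′) l<L

  entry : ∃[ p ] ¬ In p × In (next p)
  entry with offset-surjective s (≤-reflexive (suc-pred L))
  ... | p , eq = p , out-p , in-next
    where
    p+1≡L : suc (offset s p) ≡ L
    p+1≡L = trans (cong suc eq) (suc-pred L)
    out-p : ¬ In p
    out-p in-p = <⇒≱ l<L (subst (_≤ l) p+1≡L (in⇒< in-p))
    in-next : In (next p)
    in-next with offset-next s p
    ... | inj₁ eq′       = contradiction (trans eq′ p+1≡L) (<⇒≢ (offset-< s (next p)))
    ... | inj₂ (eq′ , _) = <⇒in (subst (_< l) (sym eq′) 1≤l)

  exit-unique : ∀ {p} → In p → ¬ In (next p) → p ≡ proj₁ exit
  exit-unique in-p out-next = offset-injective s (suc-injective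
    (trans (exit-offset in-p out-next) (sym (exit-offset (proj₁ (proj₂ exit)) (proj₂ (proj₂ exit))))))

  entry-unique : ∀ {p} → ¬ In p → In (next p) → p ≡ proj₁ entry
  entry-unique out-p in-next = offset-injective s (suc-injective
    (trans (entry-offset out-p in-next) (sym (entry-offset (proj₁ (proj₂ entry)) (proj₂ (proj₂ entry))))))

-- Passages of a contracted cycle through a vertex

module _ {n m : ℕ} (C : Fin m → List (Fin n)) (P : Fin n → Fin n) where

  edgeParity : List (Fin n) → Fin n → Fin n → Fin 2
  edgeParity xs u w = fwd (length xs) (pos u xs) (pos w xs) mod 2

  module _ (xs : List (Fin n)) {u w : Fin n} {b : ℕ} where

    ContrEdge⇒source : ContrEdge C P xs u w b → Contains C P xs u
    ContrEdge⇒source (inj₁ (p , Pp≡u , _))        = p , Pp≡u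
    ContrEdge⇒source (inj₂ (_ , 0<L , all≡u , _)) = fromℕ< 0<L , all≡u _

    ContrEdge⇒target : ContrEdge C P xs u w b → Contains C P xs w
    ContrEdge⇒target (inj₁ (p , _ , Pnext≡w , _))    = next p , Pnext≡w
    ContrEdge⇒target (inj₂ (refl , 0<L , all≡u , _)) = fromℕ< 0<L , all≡u _

    ContrEdge⇒boundary : (∀ u → ¬ SelfLoop C P xs u) → ContrEdge C P xs u w b →
      ∃[ p ] P (lookup xs p) ≡ u × P (lookup xs (next p)) ≡ w × u ≢ w × b ≡ toℕ (edgeParity xs u w)
    ContrEdge⇒boundary _ (inj₁ (p , Pp≡u , Pnext≡w , u≢w , par≡b)) =
      p , Pp≡u , Pnext≡w , u≢w , trans (sym par≡b) (sym (toℕ-fromℕ< _))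
    ContrEdge⇒boundary loopless (inj₂ (_ , 0<L , all≡u , _)) = contradiction (0<L , all≡u) (loopless u)

  record Passes (xs : List (Fin n)) (v x : Fin n) (px : Fin 2) (y : Fin n) (py : Fin 2) : Set where
    field
      out-edge        : ContrEdge C P xs v x (toℕ px)
      in-edge         : ContrEdge C P xs y v (toℕ py)
      out-edge-unique : ∀ {w b} → ContrEdge C P xs v w b → w ≡ x × b ≡ toℕ px
      in-edge-unique  : ∀ {w b} → ContrEdge C P xs w v b → w ≡ y × b ≡ toℕ py

  Passes-cong : ∀ {xs v x x′ px px′ y y′ py py′} → x ≡ x′ → px ≡ px′ → y ≡ y′ → py ≡ py′ →
                Passes xs v x px y py → Passes xs v x′ px′ y′ py′
  Passes-cong refl refl refl refl passes = passes

  record Passage (xs : List (Fin n)) (v : Fin n) : Set where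
    field
      successor          : Fin n
      successor-parity   : Fin 2
      predecessor        : Fin n
      predecessor-parity : Fin 2
      passes             : Passes xs v successor successor-parity predecessor predecessor-parity

  passage : ∀ {xs v} → (∀ u → ¬ SelfLoop C P xs u) → IsPathClass C P xs v → Passage xs v
  passage {xs} {v} loopless (s , l , 1≤l , _ , arc) = record
    { successor          = successor
    ; successor-parity   = edgeParity xs v successor
    ; predecessor        = predecessor
    ; predecessor-parity = edgeParity xs predecessor v
    ; passes = record
      { out-edge        = inj₁ (p⁺ , in-p⁺ , refl , out-p⁺ ∘ sym , sym (toℕ-fromℕ< _))
      ; in-edge         = inj₁ (p⁻ , refl , in-p⁻ , out-p⁻ , sym (toℕ-fromℕ< _))
      ; out-edge-unique = out-edge-unique
      ; in-edge-unique  = in-edge-unique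
      }
    }
    where
    In : Fin (length xs) → Set
    In q = P (lookup xs q) ≡ v

    proper : ¬ (∀ q → In q)
    proper all≡v = loopless v (≤-<-trans z≤n (toℕ<n s) , all≡v)

    open ProperArc In s l 1≤l arc proper

    p⁺ = proj₁ exit
    in-p⁺ = proj₁ (proj₂ exit)
    out-p⁺ = proj₂ (proj₂ exit)
    p⁻ = proj₁ entry
    out-p⁻ = proj₁ (proj₂ entry)
    in-p⁻ = proj₂ (proj₂ entry)

    successor predecessor : Fin n
    successor = P (lookup xs (next p⁺))
    predecessor = P (lookup xs p⁻)

    out-edge-unique : ∀ {w b} → ContrEdge C P xs v w b → w ≡ successor × b ≡ toℕ (edgeParity xs v successor)
    out-edge-unique e with ContrEdge⇒boundary xs loopless e
    ... | p , in-p , Pnext≡w , v≢w , b≡par = w≡successor , trans b≡par (cong (toℕ ∘ edgeParity xs v) w≡successor)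
      where
      p≡p⁺ = exit-unique in-p (λ in-next → v≢w (trans (sym in-next) Pnext≡w))
      w≡successor = trans (sym Pnext≡w) (cong (λ q → P (lookup xs (next q))) p≡p⁺)

    in-edge-unique : ∀ {w b} → ContrEdge C P xs w v b → w ≡ predecessor × b ≡ toℕ (edgeParity xs predecessor v)
    in-edge-unique e with ContrEdge⇒boundary xs loopless e
    ... | p , Pp≡w , in-next , w≢v , b≡par = w≡predecessor , trans b≡par (cong (λ u → toℕ (edgeParity xs u v)) w≡predecessor)
      where
      p≡p⁻ = entry-unique (λ in-p → w≢v (trans (sym Pp≡w) in-p)) in-next
      w≡predecessor = trans (sym Pp≡w) (cong (λ q → P (lookup xs q)) p≡p⁻)

  module _ (good : GoodPartition C P) (loopless : ∀ i u → ¬ SelfLoop C P (C i) u) where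

    pathClass : ∀ i {v} → Contains C P (C i) v → IsPathClass C P (C i) v
    pathClass i {v} (p , Pp≡v) with proj₂ (proj₂ (proj₂ good)) i v (lookup (C i) p , Pp≡v)
    ... | inj₁ misses        = contradiction Pp≡v (misses _ (∈-lookup p))
    ... | inj₂ (inj₁ covers) = contradiction (≤-<-trans z≤n (toℕ<n p) , λ q → covers _ (∈-lookup q)) (loopless i v)
    ... | inj₂ (inj₂ isPath) = isPath

    -- Opaque: only the fields of a passage are used below, and unfolding them is very slow.
    opaque
      passageAt : ∀ i {v} → Contains C P (C i) v → Passage (C i) v
      passageAt i cv = passage (loopless i) (pathClass i cv)

  module _ {S : Subset m} {v x y : Fin n} {px py : Fin 2}
           (uniform : ∀ j → j ∈ₛ S → Contains C P (C j) v → Passes (C j) v x px y py) where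

    open Passes

    neighbour-of-uniform : ∀ {w} → Adj C P S v w → w ≡ x ⊎ w ≡ y
    neighbour-of-uniform (_ , j , j∈S , inj₁ e) = inj₁ (proj₁ (out-edge-unique (uniform j j∈S (ContrEdge⇒source (C j) e)) e))
    neighbour-of-uniform (_ , j , j∈S , inj₂ e) = inj₂ (proj₁ (in-edge-unique (uniform j j∈S (ContrEdge⇒target (C j) e)) e))

    module _ (x≢y : x ≢ y) where

      parity-x-v : ∀ {b} → EdgeBetween C P S x v b → b ≡ toℕ px
      parity-x-v (j , j∈S , inj₁ e) = contradiction (proj₁ (in-edge-unique (uniform j j∈S (ContrEdge⇒target (C j) e)) e)) x≢y
      parity-x-v (j , j∈S , inj₂ e) = proj₂ (out-edge-unique (uniform j j∈S (ContrEdge⇒source (C j) e)) e)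

      parity-v-y : ∀ {b} → EdgeBetween C P S v y b → b ≡ toℕ py
      parity-v-y (j , j∈S , inj₁ e) = contradiction (sym (proj₁ (out-edge-unique (uniform j j∈S (ContrEdge⇒source (C j) e)) e))) x≢y
      parity-v-y (j , j∈S , inj₂ e) = proj₂ (in-edge-unique (uniform j j∈S (ContrEdge⇒target (C j) e)) e)

    wellContractible-of-uniform : ∀ {c} → c ∈ₛ S → Contains C P (C c) v → WellContractible C P S v
    wellContractible-of-uniform {c} c∈S cv with x ≟ y
    ... | yes refl = inj₁ (x , adj-x , λ _ → reduce ∘ neighbour-of-uniform)
      where adj-x = toℕ px , c , c∈S , inj₁ (out-edge (uniform c c∈S cv))
    ... | no x≢y = inj₂ (x , y , x≢y , adj-x , adj-y , (λ _ → neighbour-of-uniform) , contains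
                        , (λ _ _ e₁ e₂ → trans (parity-x-v x≢y e₁) (sym (parity-x-v x≢y e₂)))
                        , (λ _ _ e₁ e₂ → trans (parity-v-y x≢y e₁) (sym (parity-v-y x≢y e₂))))
      where
      adj-x = toℕ px , c , c∈S , inj₁ (out-edge (uniform c c∈S cv))
      adj-y = toℕ py , c , c∈S , inj₂ (in-edge (uniform c c∈S cv))
      contains : ∀ j → j ∈ₛ S → Contains C P (C j) v → Contains C P (C j) x × Contains C P (C j) y
      contains j j∈S cvⱼ = ContrEdge⇒target (C j) (out-edge (uniform j j∈S cvⱼ))
                         , ContrEdge⇒source (C j) (in-edge (uniform j j∈S cvⱼ))

-- Labelling the passages through marked vertices

position : ∀ {A : Set} {x : A} {xs d} → length xs ≤ d → x ∈ xs → Fin d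
position |xs|≤d x∈ = inject≤ (index x∈) |xs|≤d

position-injective : ∀ {A : Set} {x y : A} {xs d} (|xs|≤d : length xs ≤ d) (x∈ : x ∈ xs) (y∈ : y ∈ xs) →
                     position |xs|≤d x∈ ≡ position |xs|≤d y∈ → x ≡ y
position-injective {xs = xs} |xs|≤d x∈ y∈ eq =
  trans (lookup-index x∈) (trans (cong (lookup xs) (inject≤-injective _ _ _ _ eq)) (sym (lookup-index y∈)))

combine-injective : ∀ {a b} {i i′ : Fin a} {j j′ : Fin b} → combine i j ≡ combine i′ j′ → i ≡ i′ × j ≡ j′
combine-injective {b = b} {i} {i′} {j} {j′} eq =
  ,-injective (trans (sym (remQuot-combine i j)) (trans (cong (remQuot b) eq) (remQuot-combine i′ j′)))

module Labelling {n m : ℕ} (d : ℕ) (C : Fin m → List (Fin n)) (P : Fin n → Fin n)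
                 (good : GoodPartition C P) (loopless : ∀ i u → ¬ SelfLoop C P (C i) u)
                 (chosen : ∀ i → ∃[ v ] AtMostNbrs C P ⊤ d v × Contains C P (C i) v) where

  Marked : Fin n → Set
  Marked v = ∃[ i ] proj₁ (chosen i) ≡ v

  marked? : ∀ v → Dec (Marked v)
  marked? v = any? λ i → proj₁ (chosen i) ≟ v

  contains? : ∀ j v → Dec (Contains C P (C j) v)
  contains? j v = any? λ p → P (lookup (C j) p) ≟ v

  neighbourhood : ∀ v → Σ[ ns ∈ List (Fin n) ] length ns ≤ d × (Marked v → ∀ w → Adj C P ⊤ v w → w ∈ ns)
  neighbourhood v with marked? v
  ... | yes (i , refl) = let (_ , ns , |ns|≤d , complete) = proj₁ (proj₂ (chosen i)) in ns , |ns|≤d , λ _ → complete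
  ... | no unmarked    = [] , z≤n , λ marked → contradiction marked unmarked

  neighbourIndex : ∀ {v} → Marked v → ∀ w → Adj C P ⊤ v w → Fin d
  neighbourIndex {v} marked w adj = position (proj₁ (proj₂ (neighbourhood v))) (proj₂ (proj₂ (neighbourhood v)) marked w adj)

  neighbourIndex-injective : ∀ {v w w′} {marked marked′ : Marked v} {adj adj′} →
                             neighbourIndex marked w adj ≡ neighbourIndex marked′ w′ adj′ → w ≡ w′
  neighbourIndex-injective {v} = position-injective (proj₁ (proj₂ (neighbourhood v))) _ _

  Label : Set
  Label = Fin 2 × Fin d × Fin 2 × Fin d

  encode : Label → Fin (2 * d * (2 * d))
  encode (px , x , py , y) = combine (combine px x) (combine py y)

  encode-injective : ∀ {a b} → encode a ≡ encode b → a ≡ b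
  encode-injective {px , x , py , y} {px′ , x′ , py′ , y′} eq
    with combine-injective {i = combine px x} {combine px′ x′} {combine py y} {combine py′ y′} eq
  ... | out≡ , in≡ with combine-injective {i = px} {px′} {x} {x′} out≡ | combine-injective {i = py} {py′} {y} {y′} in≡
  ... | refl , refl | refl , refl = refl

  label : ∀ j {v} → Marked v → Contains C P (C j) v → Label
  label j marked cv = successor-parity   , neighbourIndex marked successor (_ , j , ∈⊤ , inj₁ out-edge)
                    , predecessor-parity , neighbourIndex marked predecessor (_ , j , ∈⊤ , inj₂ in-edge)
    where
    open Passage (passageAt C P good loopless j cv)
    open Passes passes

  label-agreement : ∀ {j j′ v} (marked marked′ : Marked v) (cv : Contains C P (C j) v) (cv′ : Contains C P (C j′) v) →
    label j marked cv ≡ label j′ marked′ cv′ →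
    let open Passage (passageAt C P good loopless j′ cv′) in
    Passes C P (C j) v successor successor-parity predecessor predecessor-parity
  label-agreement {j} _ _ cv _ eq =
    Passes-cong C P (neighbourIndex-injective (cong (proj₁ ∘ proj₂) eq)) (cong proj₁ eq)
                    (neighbourIndex-injective (cong (proj₂ ∘ proj₂ ∘ proj₂) eq)) (cong (proj₁ ∘ proj₂ ∘ proj₂) eq)
                    (Passage.passes (passageAt C P good loopless j cv))

  constraint : Fin m → Fin n → Maybe (Fin (2 * d * (2 * d)))
  constraint j v with marked? v | contains? j v
  ... | yes marked | yes cv = just (encode (label j marked cv))
  ... | _          | _      = nothing

  constraint-domain : ∀ j {v t} → constraint j v ≡ just t → v ∈ map P (C j)
  constraint-domain j {v} eq with marked? v | contains? j v
  ... | yes _ | yes (p , refl) = ∈-map⁺ P (∈-lookup p)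

  constraint-defined : ∀ j {v} → Marked v → Contains C P (C j) v →
                       ∃[ marked ] ∃[ cv ] constraint j v ≡ just (encode (label j marked cv))
  constraint-defined j {v} marked cv with marked? v | contains? j v
  ... | yes marked′ | yes cv′      = marked′ , cv′ , refl
  ... | no unmarked | _            = contradiction marked unmarked
  ... | yes _       | no uncovered = contradiction cv uncovered

  wellContractible-of-agreement : ∀ {S : Subset m} (σ : Fin n → Fin (2 * d * (2 * d))) →
    (∀ j → j ∈ₛ S → ∀ v {t} → constraint j v ≡ just t → t ≡ σ v) →
    ∀ {i} → i ∈ₛ S → WellContractible C P S (proj₁ (chosen i))
  wellContractible-of-agreement {S} σ agrees {i} i∈S = wellContractible-of-uniform C P uniform i∈S cvᵢ
    where
    v = proj₁ (chosen i)
    marked : Marked v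
    marked = i , refl
    defined-i = constraint-defined i marked (proj₂ (proj₂ (chosen i)))
    markedᵢ = proj₁ defined-i
    cvᵢ = proj₁ (proj₂ defined-i)
    open Passage (passageAt C P good loopless i cvᵢ)
    uniform : ∀ j → j ∈ₛ S → Contains C P (C j) v →
              Passes C P (C j) v successor successor-parity predecessor predecessor-parity
    uniform j j∈S cv with constraint-defined j marked cv
    ... | markedⱼ , cvⱼ , defined-j = label-agreement markedⱼ markedᵢ cvⱼ cvᵢ
      (encode-injective (trans (agrees j j∈S v defined-j) (sym (agrees i i∈S v (proj₂ (proj₂ defined-i))))))

[a*a]^k≡a^[2*k] : ∀ a k → (a * a) ^ k ≡ a ^ (2 * k)
[a*a]^k≡a^[2*k] a k = trans (cong (λ b → (a * b) ^ k) (sym (*-identityʳ a))) (^-*-assoc a 2 k)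

wellContractible-subfamily : ∀ k d {n m} .{{_ : NonZero d}} (C : Fin m → List (Fin n)) (P : Fin n → Fin n) →
  (∀ i → length (C i) ≤ k) → GoodPartition C P → (∀ i u → ¬ SelfLoop C P (C i) u) →
  (∀ i → ∃[ v ] (AtMostNbrs C P ⊤ d v × Contains C P (C i) v)) →
  Σ[ C′ ∈ Subset m ] m ≤ (2 * d) ^ (2 * k) * ∣ C′ ∣ ×
    (∀ i → i ∈ₛ C′ → ∃[ v ] (AtMostNbrs C P ⊤ d v × Contains C P (C i) v × WellContractible C P C′ v))
wellContractible-subfamily k d {m = m} C P bounded good loopless chosen =
  let σ , C′ , large , agrees = agreeing-assignment {{m*n≢0 (2 * d) (2 * d) {{m*n≢0 2 d}} {{m*n≢0 2 d}}}}
                                  k constraint (map P ∘ C) |map|≤k constraint-domain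
  in C′ , subst (λ T → m ≤ T * ∣ C′ ∣) ([a*a]^k≡a^[2*k] (2 * d) k) large
     , λ i i∈C′ → let v , small , cv = chosen i in v , small , cv , wellContractible-of-agreement σ agrees i∈C′
  where
  open Labelling d C P good loopless chosen
  |map|≤k : ∀ j → length (map P (C j)) ≤ k
  |map|≤k j = ≤-trans (≤-reflexive (length-map P (C j))) (bounded j)

lemma9 : (k n m : ℕ) (C : Fin m → List (Fin n)) (P : Fin n → Fin n) →
    (∀ i → IsCycle (C i)) → (∀ i → length (C i) ≤ k) → EdgeDisjoint C →
    GoodPartition C P →
    (∀ i u → ¬ SelfLoop C P (C i) u) →
    (∀ i → ∃[ v ] (AtMostNbrs C P ⊤ 6 v × Contains C P (C i) v)) →
    Σ (Subset m) λ C′ → m ≤ 12 ^ (2 * k) * ∣ C′ ∣ ×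
      (∀ i → i ∈ₛ C′ → ∃[ v ] (AtMostNbrs C P ⊤ 6 v × Contains C P (C i) v ×
                                 WellContractible C P C′ v))
lemma9 k n m C P _ bounded _ = wellContractible-subfamily k 6 C P bounded
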